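{- Let $\mathcal F$ be a group pair, and let $(x,y),(y,z)\in\mathcal E$. Suppose $\varphi_{yx}=\varphi_{xy}^{ -1}$. Suppose further that $$H_{xz}\subseteq\varphi_{xy}^{ -1}[K_{xy}\circ H_{yz}]\quad\text{and}\quad H_{yz}\subseteq\varphi_{yx}^{ -1}[K_{yx}\circ H_{xz}].$$ Then $$\varphi_{xy}[H_{xy}\circ H_{xz}]=K_{xy}\circ H_{yz}=H_{yx}\circ H_{yz}.$$
   Context: A group pair consists of the following data. - Pairwise disjoint groups $G_x$ ($x\in I$). - An equivalence relation $\mathcal E$ on $I$. - For each $(x,y)\in\mathcal E$, an isomorphism $\varphi_{xy}:G_x/H_{xy}\to G_y/K_{xy}$, where $H_{xy}\trianglelefteq G_x$ and $K_{xy}\trianglelefteq G_y$. $X\circ Y$ denotes the complex product of subsets of a group. Images of unions of cosets: - For $S\subseteq G_x$ a union of cosets of $H_{xy}$, $\varphi_{xy}[S]$ denotes the union of the images $\varphi_{xy}(H)$ of the cosets $H\subseteq S$. - For $T\subseteq G_y$ a union of cosets of $K_{xy}$, $\varphi_{xy}^{ -1}[T]$ denotes the union of the cosets $H$ of $H_{xy}$ with $\varphi_{xy}(H)\subseteq T$. -}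

module Defs where

open import Level using (Level; _⊔_) renaming (suc to lsuc)
open import Algebra.Bundles using (Group)
open import Relation.Binary.Core using (Rel)
open import Relation.Binary.Structures using (IsEquivalence)
open import Data.Product using (_×_; ∃; ∃₂)
open import Relation.Unary using (Pred; _≐_)

module _ {c ℓ} (G : Group c ℓ) where
  open Group G

  record IsNormalSubgroup {p} (N : Pred Carrier p) : Set (c ⊔ ℓ ⊔ p) where
    field
      resp  : ∀ {a b} → a ≈ b → N a → N b
      ε∈    : N ε
      ∙∈    : ∀ {a b} → N a → N b → N (a ∙ b)
      ⁻¹∈   : ∀ {a} → N a → N (a ⁻¹)
      conj∈ : ∀ g {a} → N a → N ((g ∙ a) ∙ g ⁻¹)

  infixl 7 _∘ₛ_
  _∘ₛ_ : ∀ {p q} → Pred Carrier p → Pred Carrier q → Pred Carrier (c ⊔ ℓ ⊔ p ⊔ q)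
  (X ∘ₛ Y) g = ∃₂ λ a b → X a × Y b × g ≈ a ∙ b

-- An isomorphism G/N → G'/M, given (as quotients are not available) by a
-- map on representatives which is well defined on cosets, a homomorphism
-- modulo M, injective on cosets and surjective on cosets.
-- Two elements a, b are in the same (left) coset of N iff a⁻¹ ∙ b ∈ N.
module _ {c ℓ c' ℓ'} (G : Group c ℓ) (G' : Group c' ℓ') where
  private
    module G  = Group G
    module G' = Group G'

  record QuotIso {p q} (N : Pred G.Carrier p) (M : Pred G'.Carrier q)
         : Set (c ⊔ ℓ ⊔ c' ⊔ ℓ' ⊔ p ⊔ q) where
    field
      f        : G.Carrier → G'.Carrier
      well-def : ∀ {a b} → N (a G.⁻¹ G.∙ b) → M (f a G'.⁻¹ G'.∙ f b)
      hom      : ∀ a b → M (f (a G.∙ b) G'.⁻¹ G'.∙ (f a G'.∙ f b))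
      inj      : ∀ {a b} → M (f a G'.⁻¹ G'.∙ f b) → N (a G.⁻¹ G.∙ b)
      surj     : ∀ d → ∃ λ a → M (f a G'.⁻¹ G'.∙ d)

  module _ {p q} {N : Pred G.Carrier p} {M : Pred G'.Carrier q} where
    -- φ[S]: union of the images φ(aN) = f(a)M of the cosets aN ⊆ S
    -- (for S a union of cosets of N, this is { d | ∃ a ∈ S, d ∈ f(a)M }).
    image : ∀ {r} → QuotIso N M → Pred G.Carrier r → Pred G'.Carrier (c ⊔ q ⊔ r)
    image φ S d = ∃ λ a → S a × M (QuotIso.f φ a G'.⁻¹ G'.∙ d)

    -- φ⁻¹[T]: union of the cosets aN with φ(aN) = f(a)M ⊆ T.
    preimage : ∀ {r} → QuotIso N M → Pred G'.Carrier r → Pred G.Carrier (c' ⊔ q ⊔ r)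
    preimage φ T a = ∀ d → M (QuotIso.f φ a G'.⁻¹ G'.∙ d) → T d

-- ψ = φ⁻¹ for φ : G/N → G'/M and ψ : G'/N' → G/M':
-- the domains/codomains match (N' = M, M' = N as subsets) and the maps
-- are mutually inverse on cosets.
module _ {c ℓ c' ℓ'} {G : Group c ℓ} {G' : Group c' ℓ'} where
  private
    module G  = Group G
    module G' = Group G'

  record IsInverseOf {p q p' q'} {N : Pred G.Carrier p} {M : Pred G'.Carrier q}
                     {N' : Pred G'.Carrier p'} {M' : Pred G.Carrier q'}
                     (ψ : QuotIso G' G N' M') (φ : QuotIso G G' N M)
                     : Set (c ⊔ ℓ ⊔ c' ⊔ ℓ' ⊔ p ⊔ q ⊔ p' ⊔ q') where
    field
      dom≐   : N' ≐ M
      cod≐   : M' ≐ N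
      left   : ∀ a → N (a G.⁻¹ G.∙ QuotIso.f ψ (QuotIso.f φ a))
      right  : ∀ b → M (b G'.⁻¹ G'.∙ QuotIso.f φ (QuotIso.f ψ b))

record GroupPair (i c ℓ p : Level) : Set (lsuc (i ⊔ c ⊔ ℓ ⊔ p)) where
  field
    I        : Set i
    G        : I → Group c ℓ
    E        : Rel I i
    E-equiv  : IsEquivalence E
    H        : ∀ {x y} → E x y → Pred (Group.Carrier (G x)) p
    K        : ∀ {x y} → E x y → Pred (Group.Carrier (G y)) p
    H-normal : ∀ {x y} (e : E x y) → IsNormalSubgroup (G x) (H e)
    K-normal : ∀ {x y} (e : E x y) → IsNormalSubgroup (G y) (K e)
    φ        : ∀ {x y} (e : E x y) → QuotIso (G x) (G y) (H e) (K e)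

module Submission where

-- Write N = H(x,y), M = K(x,y), A = H(x,z), B = H(y,z), let
-- f represent φ(x,y) and g represent φ(y,x) = φ(x,y)⁻¹.  Everything rests
-- on two facts about a normal subgroup M: the relation "same left coset"
-- is an equivalence, and the complex product M ∘ B is a union of left
-- cosets of M (it is M-saturated), because Mb = bM.
--   (⊆) The first hypothesis says f maps A into M ∘ B.  As f maps N into
--       M and is a homomorphism modulo M, it maps N ∘ A into M ∘ B; since
--       M ∘ B is saturated, the whole image φ[N ∘ A] lies in M ∘ B.
--   (⊇) For d = m b ∈ M ∘ B, the second hypothesis (with K(y,x) = N) puts
--       g b in N ∘ A, and f (g b) lies in the coset bM = mbM = dM.
--   The second equality holds because H(y,x) = K(x,y) as subsets.

open import Defs
open import Data.Product using (_×_; _,_; proj₁; proj₂)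
open import Relation.Unary using (Pred; _⊆_; _≐_)
open import Relation.Binary.Structures using (IsEquivalence)
open import Algebra.Bundles using (Group)
open import Level using (_⊔_)

module GroupFacts {c ℓ} (G : Group c ℓ) where
  open Group G
  open import Algebra.Properties.Group G
    using (\\-leftDividesˡ; //-rightDividesˡ; ⁻¹-anti-homo-∙; ⁻¹-involutive; ε⁻¹≈ε)
  open import Relation.Binary.Reasoning.Setoid setoid

  ∘ₛ-monoˡ : ∀ {p q r} {X : Pred Carrier p} {X' : Pred Carrier q} {Y : Pred Carrier r} →
             X ⊆ X' → _∘ₛ_ G X Y ⊆ _∘ₛ_ G X' Y
  ∘ₛ-monoˡ X⊆X' (a , b , a∈X , b∈Y , g≈ab) = a , b , X⊆X' a∈X , b∈Y , g≈ab

  module Cosets {p} {M : Pred Carrier p} (normal : IsNormalSubgroup G M) where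
    open IsNormalSubgroup normal

    -- u ~ v iff uM = vM.
    infix 4 _~_
    _~_ : Carrier → Carrier → Set p
    u ~ v = M (u ⁻¹ ∙ v)

    ~-reflexive : ∀ {u v} → u ≈ v → u ~ v
    ~-reflexive {u} u≈v = resp (sym (trans (∙-congˡ (sym u≈v)) (inverseˡ u))) ε∈

    ~-sym : ∀ {u v} → u ~ v → v ~ u
    ~-sym {u} u~v = resp (trans (⁻¹-anti-homo-∙ _ _) (∙-congˡ (⁻¹-involutive u))) (⁻¹∈ u~v)

    ~-trans : ∀ {u v w} → u ~ v → v ~ w → u ~ w
    ~-trans {v = v} {w} u~v v~w =
      resp (trans (assoc _ _ _) (∙-congˡ (\\-leftDividesˡ v w))) (∙∈ u~v v~w)

    ∈⇒ε~ : ∀ {u} → M u → ε ~ u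
    ∈⇒ε~ {u} u∈M = resp (sym (trans (∙-congʳ ε⁻¹≈ε) (identityˡ u))) u∈M

    ~-∈ : ∀ {u v} → M u → u ~ v → M v
    ~-∈ {u} {v} u∈M u~v = resp (\\-leftDividesˡ u v) (∙∈ u∈M u~v)

    ∙~ : ∀ {m b d} → M m → d ≈ m ∙ b → b ~ d
    ∙~ {m} {b} {d} m∈M d≈mb = resp b⁻¹mb≈b⁻¹d (conj∈ (b ⁻¹) m∈M)
      where
      b⁻¹mb≈b⁻¹d : (b ⁻¹ ∙ m) ∙ b ⁻¹ ⁻¹ ≈ b ⁻¹ ∙ d
      b⁻¹mb≈b⁻¹d = trans (∙-congˡ (⁻¹-involutive b)) (trans (assoc _ _ _) (∙-congˡ (sym d≈mb)))

    Saturated : ∀ {r} → Pred Carrier r → Set (c ⊔ p ⊔ r)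
    Saturated S = ∀ {u v} → S u → u ~ v → S v

    -- M ∘ B is saturated for every B: (m b) k = (m · b k b⁻¹) b.
    ∘ₛ-saturated : ∀ {q} {B : Pred Carrier q} → Saturated (_∘ₛ_ G M B)
    ∘ₛ-saturated {u = u} {d} (m , b , m∈M , b∈B , u≈mb) u~d =
      m ∙ ((b ∙ k) ∙ b ⁻¹) , b , ∙∈ m∈M (conj∈ b u~d) , b∈B , d≈
      where
      k = u ⁻¹ ∙ d
      d≈ : d ≈ (m ∙ ((b ∙ k) ∙ b ⁻¹)) ∙ b
      d≈ = begin
        d                          ≈⟨ \\-leftDividesˡ u d ⟨
        u ∙ k                      ≈⟨ ∙-congʳ u≈mb ⟩
        (m ∙ b) ∙ k                ≈⟨ assoc m b k ⟩
        m ∙ (b ∙ k)                ≈⟨ ∙-congˡ (//-rightDividesˡ b (b ∙ k)) ⟨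
        m ∙ (((b ∙ k) ∙ b ⁻¹) ∙ b) ≈⟨ assoc m _ b ⟨
        (m ∙ ((b ∙ k) ∙ b ⁻¹)) ∙ b ∎

    ∈∙∘ₛ : ∀ {q} {B : Pred Carrier q} {u v} → M u → _∘ₛ_ G M B v → _∘ₛ_ G M B (u ∙ v)
    ∈∙∘ₛ {u = u} u∈M (m , b , m∈M , b∈B , v≈mb) =
      u ∙ m , b , ∙∈ u∈M m∈M , b∈B , trans (∙-congˡ v≈mb) (sym (assoc u m b))

module QuotIsoFacts {c ℓ c' ℓ'} {G : Group c ℓ} {G' : Group c' ℓ'}
  {p q} {N : Pred (Group.Carrier G) p} {M : Pred (Group.Carrier G') q}
  (N-normal : IsNormalSubgroup G N) (M-normal : IsNormalSubgroup G' M)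
  (φ : QuotIso G G' N M) where
  private
    module G  = Group G
    module G' = Group G'
    module N = GroupFacts.Cosets G N-normal
    module M = GroupFacts.Cosets G' M-normal
  open GroupFacts.Cosets G' M-normal using (_~_; Saturated)
  open import Algebra.Properties.Group G' using (\\-leftDividesʳ)
  open QuotIso φ

  -- f ε ∈ M, since f ε ~ f (ε ε) ~ f ε ∙ f ε.
  fε∈M : M (f G.ε)
  fε∈M = IsNormalSubgroup.resp M-normal (\\-leftDividesʳ (f G.ε) (f G.ε)) fε~fεfε
    where
    fε~fεfε : f G.ε ~ f G.ε G'.∙ f G.ε
    fε~fεfε = M.~-trans (well-def (N.~-reflexive (G.sym (G.identityˡ G.ε)))) (hom G.ε G.ε)

  f-N⊆M : ∀ {n} → N n → M (f n)
  f-N⊆M n∈N = M.~-∈ fε∈M (well-def (N.∈⇒ε~ n∈N))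

  -- If f maps A into M ∘ B, it maps N ∘ A into M ∘ B: f (n a) ~ f n ∙ f a.
  f-∘ₛ : ∀ {r s} {A : Pred G.Carrier r} {B : Pred G'.Carrier s} →
         (∀ {a} → A a → _∘ₛ_ G' M B (f a)) →
         ∀ {u} → _∘ₛ_ G N A u → _∘ₛ_ G' M B (f u)
  f-∘ₛ fA⊆M∘B (n , a , n∈N , a∈A , u≈na) =
    M.∘ₛ-saturated (M.∈∙∘ₛ (f-N⊆M n∈N) (fA⊆M∘B a∈A)) (M.~-sym fu~fnfa)
    where
    fu~fnfa = M.~-trans (well-def (N.~-reflexive u≈na)) (hom n a)

  image⊆ : ∀ {r s} {S : Pred G.Carrier r} {T : Pred G'.Carrier s} →
           Saturated T → (∀ {a} → S a → T (f a)) → image G G' φ S ⊆ T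
  image⊆ T-saturated fS⊆T (a , a∈S , fa~d) = T-saturated (fS⊆T a∈S) fa~d

  preimage⇒ : ∀ {s} {T : Pred G'.Carrier s} {a} → preimage G G' φ T a → T (f a)
  preimage⇒ a∈φ⁻¹T = a∈φ⁻¹T (f _) (M.~-reflexive G'.refl)

  -- With an inverse ψ represented by g: if g maps B into S, then M ∘ B ⊆ φ[S],
  -- because m b ∈ bM = f (g b) M.
  module _ {p' q'} {N' : Pred G'.Carrier p'} {M' : Pred G.Carrier q'}
           {ψ : QuotIso G' G N' M'} (ψ-inverse : IsInverseOf ψ φ) where
    open IsInverseOf ψ-inverse using (right)

    ∘ₛ⊆image : ∀ {r s} {B : Pred G'.Carrier r} {S : Pred G.Carrier s} →
               (∀ {b} → B b → S (QuotIso.f ψ b)) → _∘ₛ_ G' M B ⊆ image G G' φ S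
    ∘ₛ⊆image gB⊆S (m , b , m∈M , b∈B , d≈mb) =
      QuotIso.f ψ b , gB⊆S b∈B , M.~-trans (M.~-sym (right b)) (M.∙~ m∈M d≈mb)

lemma3p11 : ∀ {i c ℓ p} (F : GroupPair i c ℓ p) →
    let open GroupPair F in
    ∀ {x y z} (exy : E x y) (eyz : E y z) →
    let eyx = IsEquivalence.sym E-equiv exy
        exz = IsEquivalence.trans E-equiv exy eyz
    in IsInverseOf (φ eyx) (φ exy) →
       H exz ⊆ preimage (G x) (G y) (φ exy) (_∘ₛ_ (G y) (K exy) (H eyz)) →
       H eyz ⊆ preimage (G y) (G x) (φ eyx) (_∘ₛ_ (G x) (K eyx) (H exz)) →
       (image (G x) (G y) (φ exy) (_∘ₛ_ (G x) (H exy) (H exz)) ≐ _∘ₛ_ (G y) (K exy) (H eyz))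
       × (_∘ₛ_ (G y) (K exy) (H eyz) ≐ _∘ₛ_ (G y) (H eyx) (H eyz))
lemma3p11 F {x} {y} {z} exy eyz inverse A⊆φ⁻¹[M∘B] B⊆ψ⁻¹[M'∘A] =
  ( image⊆ (Cosets.∘ₛ-saturated (G y) (K-normal exy)) (f-∘ₛ fA⊆M∘B)
  , ∘ₛ⊆image inverse gB⊆N∘A )
  , ( ∘ₛ-monoˡ (G y) (proj₂ dom≐) , ∘ₛ-monoˡ (G y) (proj₁ dom≐) )
  where
  open GroupPair F
  open IsInverseOf inverse using (dom≐; cod≐)
  open GroupFacts using (∘ₛ-monoˡ; module Cosets)
  eyx = IsEquivalence.sym E-equiv exy
  exz = IsEquivalence.trans E-equiv exy eyz
  module φ = QuotIsoFacts (H-normal exy) (K-normal exy) (φ exy)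
  module ψ = QuotIsoFacts (H-normal eyx) (K-normal eyx) (φ eyx)
  open φ using (image⊆; f-∘ₛ; ∘ₛ⊆image)

  fA⊆M∘B : ∀ {a} → H exz a → _∘ₛ_ (G y) (K exy) (H eyz) (QuotIso.f (φ exy) a)
  fA⊆M∘B a∈A = φ.preimage⇒ (A⊆φ⁻¹[M∘B] a∈A)

  -- g[H(y,z)] ⊆ H(x,y) ∘ H(x,z), from the second hypothesis and K(y,x) = H(x,y).
  gB⊆N∘A : ∀ {b} → H eyz b → _∘ₛ_ (G x) (H exy) (H exz) (QuotIso.f (φ eyx) b)
  gB⊆N∘A b∈B = ∘ₛ-monoˡ (G x) (proj₁ cod≐) (ψ.preimage⇒ (B⊆ψ⁻¹[M'∘A] b∈B))
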